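{- Let $\mathbf A=(A,\wedge,\vee,\cdot,\to,t,\neg)$ be an odd Sugihara monoid. Then the poset $(A_+,\le)$ is order isomorphic to $(\mathcal C(\mathbf A),\subseteq)$, the set of convex prime subalgebras of $\mathbf A$ ordered by inclusion.
   Context: A Sugihara monoid is $(A,\wedge,\vee,\cdot,\to,t,\neg)$ with $(A,\wedge,\vee)$ a distributive lattice, $(A,\cdot,t)$ a commutative monoid, $a\cdot b\le c\iff a\le b\to c$, $x\cdot x=x$, $\neg\neg x=x$, $x\to\neg y=y\to\neg x$; it is odd if $\neg t=t$. A convex prime subalgebra is a subset $C\subseteq A$ closed under $\wedge,\vee,\neg$ and containing $t$, such that ($a,c\in C$ and $a\le b\le c$) implies $b\in C$, and $a\wedge b\in C$ implies $a\in C$ or $b\in C$. $A_+$ is the set of maps $h\colon A\to\{ -1,0,1\}$ preserving $\wedge,\vee,\neg$, where $\{ -1,0,1\}$ is the chain $-1<0<1$ with $\neg x=-x$; $A_+$ is ordered pointwise by the order on $\{ -1,0,1\}$ in which $-1<0$, $1<0$ and $-1,1$ are incomparable. -}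

module Defs where

open import Level using (Level; suc; _⊔_)
open import Data.Product using (_×_)
open import Data.Sum using (_⊎_)
open import Function.Bundles using (_⇔_)
open import Relation.Binary.PropositionalEquality using (_≡_)
open import Relation.Unary using (Pred; _∈_; _⊆_)
open import Algebra.Core using (Op₁; Op₂)
open import Algebra.Structures using (IsCommutativeMonoid)
open import Algebra.Lattice.Structures using (IsDistributiveLattice)

record SugiharaMonoid (a : Level) : Set (suc a) where
  infixr 7 _·_
  infixr 6 _∧_
  infixr 5 _∨_
  infixr 4 _⇒_
  field
    Carrier : Set a
    _∧_ _∨_ _·_ _⇒_ : Op₂ Carrier
    t : Carrier
    ¬_ : Op₁ Carrier
  _≤_ : Carrier → Carrier → Set a
  x ≤ y = (x ∧ y) ≡ x
  field
    isDistributiveLattice : IsDistributiveLattice _≡_ _∨_ _∧_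
    isCommutativeMonoid   : IsCommutativeMonoid _≡_ _·_ t
    residuation           : ∀ x y z → ((x · y) ≤ z) ⇔ (x ≤ (y ⇒ z))
    idempotent            : ∀ x → (x · x) ≡ x
    involution            : ∀ x → (¬ (¬ x)) ≡ x
    contraposition        : ∀ x y → (x ⇒ ¬ y) ≡ (y ⇒ ¬ x)

Odd : ∀ {a} → SugiharaMonoid a → Set a
Odd A = ¬ t ≡ t
  where open SugiharaMonoid A

-- The three-element chain -1 < 0 < 1 with ¬x = -x.
data Three : Set where
  m1 z p1 : Three

_⊓_ : Three → Three → Three
m1 ⊓ _  = m1
z  ⊓ m1 = m1
z  ⊓ _  = z
p1 ⊓ y  = y

_⊔₃_ : Three → Three → Three
m1 ⊔₃ y  = y
z  ⊔₃ p1 = p1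
z  ⊔₃ _  = z
p1 ⊔₃ _  = p1

neg₃ : Three → Three
neg₃ m1 = p1
neg₃ z  = z
neg₃ p1 = m1

-- The order on {-1,0,1} used for A₊ : -1 < 0, 1 < 0, -1 and 1 incomparable.
data _⊑_ : Three → Three → Set where
  m1⊑m1 : m1 ⊑ m1
  m1⊑z  : m1 ⊑ z
  z⊑z   : z ⊑ z
  p1⊑p1 : p1 ⊑ p1
  p1⊑z  : p1 ⊑ z

module _ {a : Level} (A : SugiharaMonoid a) where
  open SugiharaMonoid A

  record APlus : Set a where
    field
      h      : Carrier → Three
      pres-∧ : ∀ x y → h (x ∧ y) ≡ (h x ⊓ h y)
      pres-∨ : ∀ x y → h (x ∨ y) ≡ (h x ⊔₃ h y)
      pres-¬ : ∀ x → h (¬ x) ≡ neg₃ (h x)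

  _≤₊_ : APlus → APlus → Set a
  f ≤₊ g = ∀ x → APlus.h f x ⊑ APlus.h g x

  _≈₊_ : APlus → APlus → Set a
  f ≈₊ g = ∀ x → APlus.h f x ≡ APlus.h g x

  record IsConvexPrimeSubalgebra (C : Pred Carrier a) : Set a where
    field
      ∧-closed : ∀ {x y} → x ∈ C → y ∈ C → (x ∧ y) ∈ C
      ∨-closed : ∀ {x y} → x ∈ C → y ∈ C → (x ∨ y) ∈ C
      ¬-closed : ∀ {x} → x ∈ C → (¬ x) ∈ C
      t-mem    : t ∈ C
      convex   : ∀ {x y w} → x ∈ C → w ∈ C → x ≤ y → y ≤ w → y ∈ C
      prime    : ∀ {x y} → (x ∧ y) ∈ C → (x ∈ C) ⊎ (y ∈ C)

  record ConvexPrimeSubalgebra : Set (suc a) where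
    field
      set   : Pred Carrier a
      isCPS : IsConvexPrimeSubalgebra set

  _⊆C_ : ConvexPrimeSubalgebra → ConvexPrimeSubalgebra → Set a
  C ⊆C D = ConvexPrimeSubalgebra.set C ⊆ ConvexPrimeSubalgebra.set D

  _≈C_ : ConvexPrimeSubalgebra → ConvexPrimeSubalgebra → Set a
  C ≈C D = (C ⊆C D) × (D ⊆C C)

record OrderIso {p q ℓ₁ ℓ₂ ℓ₃ ℓ₄ : Level}
  (P : Set p) (_≈P_ : P → P → Set ℓ₁) (_≤P_ : P → P → Set ℓ₂)
  (Q : Set q) (_≈Q_ : Q → Q → Set ℓ₃) (_≤Q_ : Q → Q → Set ℓ₄)
  : Set (p ⊔ q ⊔ ℓ₁ ⊔ ℓ₂ ⊔ ℓ₃ ⊔ ℓ₄) where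
  field
    to       : P → Q
    from     : Q → P
    to-mono  : ∀ {x y} → x ≤P y → to x ≤Q to y
    from-mono : ∀ {x y} → x ≤Q y → from x ≤P from y
    from-to  : ∀ x → from (to x) ≈P x
    to-from  : ∀ y → to (from y) ≈Q y

module Submission where

-- An element h of A₊ yields the convex
-- prime subalgebra h⁻¹(0); conversely a convex prime subalgebra C yields
-- h by reading every x relative to C:
--   x is low  (h x ∈ {-1,0})  iff  x ∨ t ∈ C,     x is high  iff  ¬x is low,
-- and h x = -1, 0, 1 according as x is low only, both, or high only.  For C, the
-- "low" predicate turns ∧ into "or", ∨ into "and", and every x is low or
-- high; with excluded middle deciding the bits this makes h a ∧,∨,¬-map,
-- and C is exactly the set of elements both low and high.  Zero sets of
-- elements of A₊ are convex prime subalgebras, and the two constructions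
-- are monotone and mutually inverse.

open import Defs
open import Axiom.ExcludedMiddle using (ExcludedMiddle)
open import Level using (Level; Lift; lift)
open import Data.Bool using (Bool; true; false; _∧_; _∨_; f≤t; b≤b)
  renaming (_≤_ to _≤ᵇ_)
open import Data.Product using (_×_; _,_)
open import Data.Sum using (_⊎_; inj₁; inj₂)
open import Function.Bundles using (_⇔_; mk⇔; Equivalence)
open import Relation.Nullary.Decidable using (Dec; yes; no; does; _⊎-dec_; _×-dec_; does-⇔; dec-true)
open import Relation.Binary.PropositionalEquality
  using (_≡_; refl; sym; trans; cong; cong₂; subst; subst₂)
open import Algebra.Structures using (IsCommutativeMonoid)
open import Algebra.Lattice.Structures using (IsDistributiveLattice)
open import Algebra.Lattice.Bundles using (Lattice)
import Algebra.Lattice.Properties.Lattice as LatticeProperties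
import Relation.Binary.Lattice.Properties.JoinSemilattice as JoinProperties
import Relation.Binary.Lattice as OrderLattice

-- {-1,0,1} as pairs of bits.

-- The value with the given (low, high) bits; (false, false) is unused.
fromBits : Bool → Bool → Three
fromBits true  true  = z
fromBits true  false = m1
fromBits false true  = p1
fromBits false false = z

fromBits-swap : ∀ a b → neg₃ (fromBits a b) ≡ fromBits b a
fromBits-swap true  true  = refl
fromBits-swap true  false = refl
fromBits-swap false true  = refl
fromBits-swap false false = refl

fromBits-⊓ : ∀ a b c d → (a ∨ b) ≡ true → (c ∨ d) ≡ true →
             fromBits (a ∨ c) (b ∧ d) ≡ fromBits a b ⊓ fromBits c d
fromBits-⊓ true  true  true  true  _ _ = refl
fromBits-⊓ true  true  true  false _ _ = refl
fromBits-⊓ true  true  false true  _ _ = refl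
fromBits-⊓ true  false true  true  _ _ = refl
fromBits-⊓ true  false true  false _ _ = refl
fromBits-⊓ true  false false true  _ _ = refl
fromBits-⊓ false true  true  true  _ _ = refl
fromBits-⊓ false true  true  false _ _ = refl
fromBits-⊓ false true  false true  _ _ = refl
fromBits-⊓ _     _     false false _ ()
fromBits-⊓ false false _     _     () _

fromBits-⊔ : ∀ a b c d → (a ∨ b) ≡ true → (c ∨ d) ≡ true →
             fromBits (a ∧ c) (b ∨ d) ≡ fromBits a b ⊔₃ fromBits c d
fromBits-⊔ true  true  true  true  _ _ = refl
fromBits-⊔ true  true  true  false _ _ = refl
fromBits-⊔ true  true  false true  _ _ = refl
fromBits-⊔ true  false true  true  _ _ = refl
fromBits-⊔ true  false true  false _ _ = refl
fromBits-⊔ true  false false true  _ _ = refl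
fromBits-⊔ false true  true  true  _ _ = refl
fromBits-⊔ false true  true  false _ _ = refl
fromBits-⊔ false true  false true  _ _ = refl
fromBits-⊔ _     _     false false _ ()
fromBits-⊔ false false _     _     () _

fromBits-mono : ∀ {a b c d} → a ≤ᵇ c → b ≤ᵇ d → (a ∨ b) ≡ true →
                fromBits a b ⊑ fromBits c d
fromBits-mono {true}  {true}  b≤b b≤b _ = z⊑z
fromBits-mono {true}  {false} b≤b f≤t _ = m1⊑z
fromBits-mono {true}  {false} b≤b b≤b _ = m1⊑m1
fromBits-mono {false} {true}  f≤t b≤b _ = p1⊑z
fromBits-mono {false} {true}  b≤b b≤b _ = p1⊑p1
fromBits-mono {false} {false} _   _   ()

fromBits-zero : ∀ a b → (a ∨ b) ≡ true → fromBits a b ≡ z → (a ≡ true) × (b ≡ true)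
fromBits-zero true  true  _ _ = refl , refl
fromBits-zero true  false _ ()
fromBits-zero false true  _ ()
fromBits-zero false false () _

isLow? : (v : Three) → Dec ((v ⊔₃ z) ≡ z)
isLow? m1 = yes refl
isLow? z  = yes refl
isLow? p1 = no λ ()

fromBits-isLow : ∀ v → fromBits (does (isLow? v)) (does (isLow? (neg₃ v))) ≡ v
fromBits-isLow m1 = refl
fromBits-isLow z  = refl
fromBits-isLow p1 = refl

neg₃-fixed : ∀ v → v ≡ neg₃ v → v ≡ z
neg₃-fixed m1 ()
neg₃-fixed z  _ = refl
neg₃-fixed p1 ()

zero-between : ∀ v → (z ⊓ v) ≡ z → (v ⊓ z) ≡ v → v ≡ z
zero-between m1 () _
zero-between z  _ _ = refl
zero-between p1 _ ()

⊓-zero : ∀ u v → (u ⊓ v) ≡ z → (u ≡ z) ⊎ (v ≡ z)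
⊓-zero m1 _ ()
⊓-zero z  _ _ = inj₁ refl
⊓-zero p1 _ e = inj₂ e

⊑-zero : ∀ {u v} → u ⊑ v → u ≡ z → v ≡ z
⊑-zero z⊑z refl = refl

does-mono : ∀ {a} {P Q : Set a} (p? : Dec P) (q? : Dec Q) → (P → Q) → does p? ≤ᵇ does q?
does-mono (yes p) (yes _) _   = b≤b
does-mono (yes p) (no ¬q) P→Q with () ← ¬q (P→Q p)
does-mono (no _)  (yes _) _   = f≤t
does-mono (no _)  (no _)  _   = b≤b

does-true : ∀ {a} {P : Set a} (p? : Dec P) → does p? ≡ true → P
does-true (yes p) _ = p

does-cover : ∀ {a} {P Q : Set a} (p? : Dec P) (q? : Dec Q) → P ⊎ Q → (does p? ∨ does q?) ≡ true
does-cover p? q? pq = dec-true (p? ⊎-dec q?) pq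

-- General facts about Sugihara monoids.

module SugiharaFacts {a : Level} (A : SugiharaMonoid a) where
  open SugiharaMonoid A public
    using (Carrier; t; ¬_; _·_; _⇒_; involution; contraposition)
    renaming (_∧_ to _⋀_; _∨_ to _⋁_)
  open SugiharaMonoid A using (_≤_; residuation; isCommutativeMonoid; isDistributiveLattice)
  module M = IsCommutativeMonoid isCommutativeMonoid
  module D = IsDistributiveLattice isDistributiveLattice

  lattice : Lattice a a
  lattice = record { isLattice = D.isLattice }

  -- Its order x ≼ y is x ≡ x ⋀ y.
  orderLattice : OrderLattice.Lattice a a a
  orderLattice = LatticeProperties.∨-∧-orderTheoreticLattice lattice

  open OrderLattice.Lattice orderLattice public
    using (x∧y≤x; x∧y≤y; ∧-greatest; x≤x∨y; y≤x∨y; ∨-least)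
    renaming (_≤_ to _≼_; refl to ≼-refl; trans to ≼-trans; antisym to ≼-antisym)
  open JoinProperties (OrderLattice.Lattice.joinSemilattice orderLattice) public
    using (∨-monotonic; x≤y⇒x∨y≈y)

  -- The order of the Sugihara monoid is the same relation, flipped.
  ≤⇒≼ : ∀ {x y} → x ≤ y → x ≼ y
  ≤⇒≼ = sym

  ≼⇒≤ : ∀ {x y} → x ≼ y → x ≤ y
  ≼⇒≤ = sym

  residuate : ∀ {x y w} → (x · y) ≼ w → x ≼ (y ⇒ w)
  residuate p = ≤⇒≼ (Equivalence.to (residuation _ _ _) (≼⇒≤ p))

  unresiduate : ∀ {x y w} → x ≼ (y ⇒ w) → (x · y) ≼ w
  unresiduate p = ≤⇒≼ (Equivalence.from (residuation _ _ _) (≼⇒≤ p))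

  ·-monoˡ : ∀ {x y} c → x ≼ y → (x · c) ≼ (y · c)
  ·-monoˡ {y = y} c x≼y = unresiduate (≼-trans x≼y (residuate (≼-refl {y · c})))

  ·-monoʳ : ∀ {x y} c → x ≼ y → (c · x) ≼ (c · y)
  ·-monoʳ {x} {y} c x≼y = subst₂ _≼_ (M.comm x c) (M.comm y c) (·-monoˡ c x≼y)

  t⇒ : ∀ w → (t ⇒ w) ≡ w
  t⇒ w = ≼-antisym
    (subst (_≼ w) (M.identityʳ (t ⇒ w)) (unresiduate ≼-refl))
    (residuate (subst (_≼ w) (sym (M.identityʳ w)) ≼-refl))

  ¬-as-⇒ : ∀ x → (¬ x) ≡ (x ⇒ ¬ t)
  ¬-as-⇒ x = trans (sym (t⇒ (¬ x))) (sym (contraposition x t))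

  ¬-antitone : ∀ {x y} → x ≼ y → (¬ y) ≼ (¬ x)
  ¬-antitone {x} {y} x≼y = subst₂ _≼_ (sym (¬-as-⇒ y)) (sym (¬-as-⇒ x))
    (residuate (≼-trans (·-monoʳ (y ⇒ ¬ t) x≼y) (unresiduate ≼-refl)))

  ¬-swap : ∀ {x y} → x ≼ (¬ y) → y ≼ (¬ x)
  ¬-swap {y = y} p = subst (_≼ _) (involution y) (¬-antitone p)

  -- Both De Morgan laws follow from ¬ being an antitone involution.
  deMorgan-∨ : ∀ x y → (¬ (x ⋁ y)) ≡ ((¬ x) ⋀ (¬ y))
  deMorgan-∨ x y = ≼-antisym
    (∧-greatest (¬-antitone (x≤x∨y x y)) (¬-antitone (y≤x∨y x y)))
    (¬-swap (∨-least (¬-swap (x∧y≤x (¬ x) (¬ y))) (¬-swap (x∧y≤y (¬ x) (¬ y)))))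

  deMorgan-∧ : ∀ x y → (¬ (x ⋀ y)) ≡ ((¬ x) ⋁ (¬ y))
  deMorgan-∧ x y = begin
    ¬ (x ⋀ y)                     ≡⟨ cong ¬_ (cong₂ _⋀_ (involution x) (involution y)) ⟨
    ¬ ((¬ ¬ x) ⋀ (¬ ¬ y))         ≡⟨ cong ¬_ (deMorgan-∨ (¬ x) (¬ y)) ⟨
    ¬ ¬ ((¬ x) ⋁ (¬ y))           ≡⟨ involution _ ⟩
    (¬ x) ⋁ (¬ y)                 ∎
    where open Relation.Binary.PropositionalEquality.≡-Reasoning

  -- Kleene inequality, from idempotence: x ∧ ¬x = (x ∧ ¬x)² ≤ x · ¬x ≤ ¬t.
  kleene : ∀ x → (x ⋀ (¬ x)) ≼ (¬ t)
  kleene x = subst (_≼ ¬ t) (SugiharaMonoid.idempotent A (x ⋀ (¬ x)))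
    (≼-trans (≼-trans (·-monoˡ _ (x∧y≤x x (¬ x))) (·-monoʳ x (x∧y≤y x (¬ x))))
             (unresiduate x≼¬x⇒¬t))
    where
    x≼¬x⇒¬t : x ≼ ((¬ x) ⇒ ¬ t)
    x≼¬x⇒¬t = subst (x ≼_) (trans (sym (involution x)) (¬-as-⇒ (¬ x))) ≼-refl

-- From a convex prime subalgebra to an element of A₊.

module FromSubalgebra {a : Level} (lem : ExcludedMiddle a) (A : SugiharaMonoid a)
                      (odd : Odd A) (C : ConvexPrimeSubalgebra A) where
  open SugiharaFacts A
  open ConvexPrimeSubalgebra C renaming (set to S)
  open IsConvexPrimeSubalgebra isCPS

  between : ∀ {x y w} → S x → S w → x ≼ y → y ≼ w → S y
  between sx sw x≼y y≼w = convex sx sw (≼⇒≤ x≼y) (≼⇒≤ y≼w)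

  -- x is low for C (its value will be -1 or 0); x is high if ¬x is low.
  Low High : Carrier → Set a
  Low x  = S (x ⋁ t)
  High x = Low (¬ x)

  -- High x says x ⋀ t ∈ C, because ¬(¬x ⋁ t) = x ⋀ t as ¬t = t.
  ¬[¬x⋁t] : ∀ x → (¬ ((¬ x) ⋁ t)) ≡ (x ⋀ t)
  ¬[¬x⋁t] x = trans (deMorgan-∨ (¬ x) t) (cong₂ _⋀_ (involution x) odd)

  -- Being low is inherited downwards: t ≼ x ⋁ t ≼ y ⋁ t with y ⋁ t ∈ C.
  Low-antitone : ∀ {x y} → x ≼ y → Low y → Low x
  Low-antitone x≼y low-y = between t-mem low-y (y≤x∨y _ t) (∨-monotonic x≼y ≼-refl)

  -- A join is low iff both parts are; the converse uses ∨-closure and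
  -- (x ⋁ y) ⋁ t ≼ (x ⋁ t) ⋁ (y ⋁ t).
  Low-∨ : ∀ {x y} → Low (x ⋁ y) ⇔ (Low x × Low y)
  Low-∨ {x} {y} = mk⇔
    (λ l → Low-antitone (x≤x∨y x y) l , Low-antitone (y≤x∨y x y) l)
    (λ (lx , ly) → between t-mem (∨-closed lx ly) (y≤x∨y _ t)
       (∨-least (∨-monotonic (x≤x∨y x t) (x≤x∨y y t)) (≼-trans (y≤x∨y x t) (x≤x∨y _ _))))

  -- A meet is low iff one part is: by distributivity
  -- (x ⋀ y) ⋁ t = (x ⋁ t) ⋀ (y ⋁ t), so primeness of C applies.
  Low-∧ : ∀ {x y} → Low (x ⋀ y) ⇔ (Low x ⊎ Low y)
  Low-∧ {x} {y} = mk⇔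
    (λ l → prime (subst S (D.∨-distribʳ-∧ t x y) l))
    λ { (inj₁ lx) → Low-antitone (x∧y≤x x y) lx ; (inj₂ ly) → Low-antitone (x∧y≤y x y) ly }

  High-∧ : ∀ {x y} → High (x ⋀ y) ⇔ (High x × High y)
  High-∧ {x} {y} = mk⇔
    (λ h → Equivalence.to Low-∨ (subst Low (deMorgan-∧ x y) h))
    (λ hs → subst Low (sym (deMorgan-∧ x y)) (Equivalence.from Low-∨ hs))

  High-∨ : ∀ {x y} → High (x ⋁ y) ⇔ (High x ⊎ High y)
  High-∨ {x} {y} = mk⇔
    (λ h → Equivalence.to Low-∧ (subst Low (deMorgan-∨ x y) h))
    (λ hs → subst Low (sym (deMorgan-∨ x y)) (Equivalence.from Low-∧ hs))

  High-¬ : ∀ {x} → High (¬ x) ⇔ Low x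
  High-¬ {x} = mk⇔ (subst Low (involution x)) (subst Low (sym (involution x)))

  -- Every element is low or high: (x ⋁ t) ⋀ (¬x ⋁ t) = (x ⋀ ¬x) ⋁ t = t
  -- by the Kleene inequality, and t ∈ C is prime.
  low-or-high : ∀ x → Low x ⊎ High x
  low-or-high x = prime (subst S t≡meet t-mem)
    where
    t≡meet : t ≡ ((x ⋁ t) ⋀ ((¬ x) ⋁ t))
    t≡meet = trans (sym (x≤y⇒x∨y≈y (subst (_ ≼_) odd (kleene x)))) (D.∨-distribʳ-∧ t x (¬ x))

  ∈⇒low-high : ∀ {x} → S x → Low x × High x
  ∈⇒low-high sx = ∨-closed sx t-mem , ∨-closed (¬-closed sx) t-mem

  low-high⇒∈ : ∀ {x} → Low x → High x → S x
  low-high⇒∈ {x} lx hx =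
    between (subst S (¬[¬x⋁t] x) (¬-closed hx)) lx (x∧y≤x x t) (x≤x∨y x t)

  lowBit : Carrier → Bool
  lowBit x = does (lem {Low x})

  sign : Carrier → Three
  sign x = fromBits (lowBit x) (lowBit (¬ x))

  valid : ∀ x → (lowBit x ∨ lowBit (¬ x)) ≡ true
  valid x = does-cover lem lem (low-or-high x)

  sign-∧ : ∀ x y → sign (x ⋀ y) ≡ sign x ⊓ sign y
  sign-∧ x y = begin
    fromBits (lowBit (x ⋀ y)) (lowBit (¬ (x ⋀ y)))
      ≡⟨ cong₂ fromBits (does-⇔ Low-∧ lem (lem ⊎-dec lem)) (does-⇔ High-∧ lem (lem ×-dec lem)) ⟩
    fromBits (lowBit x ∨ lowBit y) (lowBit (¬ x) ∧ lowBit (¬ y))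
      ≡⟨ fromBits-⊓ (lowBit x) (lowBit (¬ x)) (lowBit y) (lowBit (¬ y)) (valid x) (valid y) ⟩
    sign x ⊓ sign y ∎
    where open Relation.Binary.PropositionalEquality.≡-Reasoning

  sign-∨ : ∀ x y → sign (x ⋁ y) ≡ sign x ⊔₃ sign y
  sign-∨ x y = begin
    fromBits (lowBit (x ⋁ y)) (lowBit (¬ (x ⋁ y)))
      ≡⟨ cong₂ fromBits (does-⇔ Low-∨ lem (lem ×-dec lem)) (does-⇔ High-∨ lem (lem ⊎-dec lem)) ⟩
    fromBits (lowBit x ∧ lowBit y) (lowBit (¬ x) ∨ lowBit (¬ y))
      ≡⟨ fromBits-⊔ (lowBit x) (lowBit (¬ x)) (lowBit y) (lowBit (¬ y)) (valid x) (valid y) ⟩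
    sign x ⊔₃ sign y ∎
    where open Relation.Binary.PropositionalEquality.≡-Reasoning

  sign-¬ : ∀ x → sign (¬ x) ≡ neg₃ (sign x)
  sign-¬ x = trans (cong (fromBits (lowBit (¬ x))) (does-⇔ High-¬ lem lem))
                   (sym (fromBits-swap (lowBit x) (lowBit (¬ x))))

  signHom : APlus A
  signHom = record { h = sign ; pres-∧ = sign-∧ ; pres-∨ = sign-∨ ; pres-¬ = sign-¬ }

  sign-zero⇒∈ : ∀ {x} → sign x ≡ z → S x
  sign-zero⇒∈ {x} sx≡z with fromBits-zero _ _ (valid x) sx≡z
  ... | low , high = low-high⇒∈ (does-true lem low) (does-true lem high)

  ∈⇒sign-zero : ∀ {x} → S x → sign x ≡ z
  ∈⇒sign-zero {x} sx with ∈⇒low-high sx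
  ... | low , high = cong₂ fromBits (dec-true lem low) (dec-true lem high)

-- From an element of A₊ to a convex prime subalgebra.

module ZeroSet {a : Level} (A : SugiharaMonoid a) (odd : Odd A) (f : APlus A) where
  open SugiharaFacts A
  open SugiharaMonoid A using (_≤_)
  open APlus f

  h-monotone : ∀ {x y} → x ≤ y → (h x ⊓ h y) ≡ h x
  h-monotone {x} {y} x≤y = trans (sym (pres-∧ x y)) (cong h x≤y)

  -- t = ¬t is sent to a fixed point of neg₃.
  h-t : h t ≡ z
  h-t = neg₃-fixed (h t) (trans (cong h (sym odd)) (pres-¬ t))

  -- The zero set of h is a convex prime subalgebra: convexity and
  -- primeness hold already in {-1,0,1}.
  Zero : Carrier → Set a
  Zero x = Lift a (h x ≡ z)

  isConvexPrime : IsConvexPrimeSubalgebra A Zero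
  isConvexPrime = record
    { ∧-closed = λ {x} {y} (lift hx) (lift hy) → lift (trans (pres-∧ x y) (cong₂ _⊓_ hx hy))
    ; ∨-closed = λ {x} {y} (lift hx) (lift hy) → lift (trans (pres-∨ x y) (cong₂ _⊔₃_ hx hy))
    ; ¬-closed = λ {x} (lift hx) → lift (trans (pres-¬ x) (cong neg₃ hx))
    ; t-mem    = lift h-t
    ; convex   = λ {x} {y} {w} (lift hx) (lift hw) x≤y y≤w → lift (zero-between (h y)
        (trans (cong (_⊓ h y) (sym hx)) (trans (h-monotone x≤y) hx))
        (trans (cong (h y ⊓_) (sym hw)) (h-monotone y≤w)))
    ; prime    = λ {x} {y} (lift hxy) → lift-⊎ (⊓-zero (h x) (h y) (trans (sym (pres-∧ x y)) hxy))
    }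
    where
    lift-⊎ : ∀ {x y} → (h x ≡ z) ⊎ (h y ≡ z) → Zero x ⊎ Zero y
    lift-⊎ (inj₁ e) = inj₁ (lift e)
    lift-⊎ (inj₂ e) = inj₂ (lift e)

  zeroSet : ConvexPrimeSubalgebra A
  zeroSet = record { set = Zero ; isCPS = isConvexPrime }

  low-zeroSet : ∀ x → Zero (x ⋁ t) ⇔ ((h x ⊔₃ z) ≡ z)
  low-zeroSet x = mk⇔ (λ (lift e) → trans (sym h[x⋁t]) e) (λ e → lift (trans h[x⋁t] e))
    where
    h[x⋁t] : h (x ⋁ t) ≡ (h x ⊔₃ z)
    h[x⋁t] = trans (pres-∨ x t) (cong (h x ⊔₃_) h-t)

module _ {a : Level} (lem : ExcludedMiddle a) (A : SugiharaMonoid a) (odd : Odd A) where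
  open SugiharaFacts A using (¬_)
  open FromSubalgebra lem A odd using (signHom; valid; sign-zero⇒∈; ∈⇒sign-zero)
  open ZeroSet A odd using (zeroSet; low-zeroSet)

  zeroSet-mono : ∀ {f g} → _≤₊_ A f g → _⊆C_ A (zeroSet f) (zeroSet g)
  zeroSet-mono {f} {g} f≤g {x} (lift fx) = lift (⊑-zero (f≤g x) fx)

  -- A larger subalgebra makes more elements low and more elements high.
  signHom-mono : ∀ {C D} → _⊆C_ A C D → _≤₊_ A (signHom C) (signHom D)
  signHom-mono {C} {D} C⊆D x =
    fromBits-mono (does-mono lem lem C⊆D) (does-mono lem lem C⊆D) (valid C x)

  signHom-zeroSet : ∀ f → _≈₊_ A (signHom (zeroSet f)) f
  signHom-zeroSet f x = begin
    APlus.h (signHom (zeroSet f)) x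
      ≡⟨ cong₂ fromBits (does-⇔ (low-zeroSet f x) lem (isLow? (h x)))
                        (does-⇔ (low-zeroSet f (¬ x)) lem (isLow? (h (¬ x)))) ⟩
    fromBits (does (isLow? (h x))) (does (isLow? (h (¬ x))))
      ≡⟨ cong (λ v → fromBits (does (isLow? (h x))) (does (isLow? v))) (pres-¬ x) ⟩
    fromBits (does (isLow? (h x))) (does (isLow? (neg₃ (h x))))
      ≡⟨ fromBits-isLow (h x) ⟩
    h x ∎
    where
    open APlus f
    open Relation.Binary.PropositionalEquality.≡-Reasoning

  zeroSet-signHom : ∀ C → _≈C_ A (zeroSet (signHom C)) C
  zeroSet-signHom C = (λ (lift sx≡z) → sign-zero⇒∈ C sx≡z) , (λ x∈C → lift (∈⇒sign-zero C x∈C))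

  signIso : OrderIso (APlus A) (_≈₊_ A) (_≤₊_ A) (ConvexPrimeSubalgebra A) (_≈C_ A) (_⊆C_ A)
  signIso = record
    { to        = zeroSet
    ; from      = signHom
    ; to-mono   = λ {f} {g} → zeroSet-mono {f} {g}
    ; from-mono = λ {C} {D} → signHom-mono {C} {D}
    ; from-to   = signHom-zeroSet
    ; to-from   = zeroSet-signHom
    }

mainTheorem16 : ∀ {a} → ExcludedMiddle a → (A : SugiharaMonoid a) → Odd A →
    OrderIso (APlus A) (_≈₊_ A) (_≤₊_ A)
    (ConvexPrimeSubalgebra A) (_≈C_ A) (_⊆C_ A)
mainTheorem16 = signIso
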